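{- In microCCS, if $P\sim Q$ then $P\sigma\sim Q\sigma$ for every substitution $\sigma$.
   Context: MicroCCS processes: $\eta ::= a \mid \overline{a}$ (names $a$), $P ::= \mathbf{0} \mid \eta.P \mid P|Q$. Transitions: $\eta.P\xrightarrow{\eta}P$; if $P\xrightarrow{\eta}P'$, $Q\xrightarrow{\overline\eta}Q'$ then $P|Q\xrightarrow{\tau}P'|Q'$; if $P\xrightarrow{\mu}P'$ then $P|Q\xrightarrow{\mu}P'|Q$ and $Q|P\xrightarrow{\mu}Q|P'$. Strong bisimilarity $\sim$ is the union of all symmetric relations $\mathcal R$ such that $P\mathcal RQ$, $P\xrightarrow{\mu}P'$ imply $Q\xrightarrow{\mu}Q'$ with $P'\mathcal RQ'$. A substitution $\sigma$ is a map from names to names; $P\sigma$ replaces each prefix $a$ by $\sigma(a)$ and each $\overline a$ by $\overline{\sigma(a)}$. -}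

module Defs where

open import Level using (0ℓ; suc)
open import Data.Product using (Σ; Σ-syntax; ∃; ∃-syntax; _×_; _,_)

module MicroCCS (Name : Set) where

  data Prefix : Set where
    inp : Name → Prefix
    out : Name → Prefix

  co : Prefix → Prefix
  co (inp a) = out a
  co (out a) = inp a

  data Act : Set where
    vis : Prefix → Act
    τ   : Act

  data Proc : Set where
    𝟎   : Proc
    _∙_ : Prefix → Proc → Proc
    _∣_ : Proc → Proc → Proc

  infixr 6 _∙_
  infixl 5 _∣_

  data _—[_]→_ : Proc → Act → Proc → Set where
    pre  : ∀ {η P} → (η ∙ P) —[ vis η ]→ P
    com  : ∀ {P P′ Q Q′ η} → P —[ vis η ]→ P′ → Q —[ vis (co η) ]→ Q′ →
           (P ∣ Q) —[ τ ]→ (P′ ∣ Q′)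
    parL : ∀ {P P′ Q μ} → P —[ μ ]→ P′ → (P ∣ Q) —[ μ ]→ (P′ ∣ Q)
    parR : ∀ {P P′ Q μ} → P —[ μ ]→ P′ → (Q ∣ P) —[ μ ]→ (Q ∣ P′)

  Rel : Set₁
  Rel = Proc → Proc → Set

  Symmetric : Rel → Set
  Symmetric R = ∀ {P Q} → R P Q → R Q P

  IsSimulation : Rel → Set
  IsSimulation R = ∀ {P Q μ P′} → R P Q → P —[ μ ]→ P′ →
                   ∃[ Q′ ] (Q —[ μ ]→ Q′ × R P′ Q′)

  IsBisimulation : Rel → Set
  IsBisimulation R = Symmetric R × IsSimulation R

  _∼_ : Proc → Proc → Set₁
  P ∼ Q = Σ[ R ∈ Rel ] (IsBisimulation R × R P Q)

  Subst : Set
  Subst = Name → Name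

  substPre : Subst → Prefix → Prefix
  substPre σ (inp a) = inp (σ a)
  substPre σ (out a) = out (σ a)

  _[_] : Proc → Subst → Proc
  𝟎 [ σ ] = 𝟎
  (η ∙ P) [ σ ] = substPre σ η ∙ (P [ σ ])
  (P ∣ Q) [ σ ] = (P [ σ ]) ∣ (Q [ σ ])

{-# OPTIONS --safe #-}
module Submission where

-- Substitution can create τ-steps (a ∣ b̄ becomes c ∣ c̄ when σ a = σ b = c), so it
-- does not obviously preserve ∼. But ∼ coincides with the bisimilarity ≈ that
-- observes visible actions only, and the visible steps of P [ σ ] are exactly
-- the images of those of P, so ≈ is preserved by substitution.
-- Why ≈ also matches τ-steps: a τ-step A → A′ synchronises steps A → A₁ and
-- A → A₂ on complementary actions, and then A₁ ∣ A₂ ≈ A′ ∣ A. If A ≈ B, then B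
-- answers with B₁ ≈ A₁ and B₂ ≈ A₂, which again synchronise to a τ-step
-- B → B′ with B₁ ∣ B₂ ≈ B′ ∣ B. Hence A′ ∣ A ≈ B′ ∣ A, and A′ ≈ B′ because
-- parallel components cancel.

open import Defs
open import Algebra.Bundles using (CommutativeSemigroup)
import Algebra.Properties.CommutativeSemigroup as CommutativeSemigroupProperties
open import Data.Nat using (ℕ; suc; _+_; _<_)
open import Data.Nat.Induction using (<-wellFounded)
open import Data.Nat.Properties using (n<1+n; +-monoˡ-<; +-monoʳ-<)
open import Data.Product using (∃-syntax; _×_; _,_)
open import Function using (_∘_)
open import Induction.WellFounded using (WellFounded; Acc; acc; module Subrelation)
open import Relation.Binary.Bundles using (Setoid)
open import Relation.Binary.Structures using (IsEquivalence)
import Relation.Binary.Construct.On as On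
import Relation.Binary.Reasoning.Setoid as SetoidReasoning
open import Relation.Binary.PropositionalEquality using (_≡_; refl; sym; subst)

module _ {Name : Set} where
  open MicroCCS Name

  private variable
    A A′ A₁ A₂ B B₁ B₂ C C′ P P′ Q Q′ R : Proc
    η : Prefix

  co-involutive : ∀ η → co (co η) ≡ η
  co-involutive (inp a) = refl
  co-involutive (out a) = refl

  size : Proc → ℕ
  size 𝟎       = 0
  size (η ∙ P) = suc (size P)
  size (P ∣ Q) = size P + size Q

  vis-step⇒size< : P —[ vis η ]→ P′ → size P′ < size P
  vis-step⇒size< {P = η ∙ P}  pre      = n<1+n (size P)
  vis-step⇒size< {P = _ ∣ Q}  (parL t) = +-monoˡ-< (size Q) (vis-step⇒size< t)
  vis-step⇒size< {P = Q ∣ _}  (parR t) = +-monoʳ-< (size Q) (vis-step⇒size< t)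

  _≺_ : Rel
  P′ ≺ P = ∃[ η ] (P —[ vis η ]→ P′)

  ≺-wellFounded : WellFounded _≺_
  ≺-wellFounded = Subrelation.wellFounded (λ (_ , t) → vis-step⇒size< t)
                                          (On.wellFounded size <-wellFounded)

  -- Only visible actions are observed (τ-steps are matched by ≈-τ-match).
  -- As processes are finite, ≈ can be inductive and lives in Set, unlike _∼_.
  infix 4 _≈_
  data _≈_ (P Q : Proc) : Set where
    bis : (∀ {η P′} → P —[ vis η ]→ P′ → ∃[ Q′ ] (Q —[ vis η ]→ Q′ × P′ ≈ Q′)) →
          (∀ {η Q′} → Q —[ vis η ]→ Q′ → ∃[ P′ ] (P —[ vis η ]→ P′ × P′ ≈ Q′)) →
          P ≈ Q

  IsVisibleSimulation : Rel → Set
  IsVisibleSimulation R = ∀ {P Q η P′} → R P Q → P —[ vis η ]→ P′ →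
                          ∃[ Q′ ] (Q —[ vis η ]→ Q′ × R P′ Q′)

  visible-bisimulation⊆≈ : {R : Rel} → Symmetric R → IsVisibleSimulation R →
                           R P Q → P ≈ Q
  visible-bisimulation⊆≈ {R = R} R-sym R-sim = go (≺-wellFounded _)
    where
    go : Acc _≺_ P → R P Q → P ≈ Q
    go {P} {Q} (acc rs) r = bis forth back
      where
      forth : P —[ vis η ]→ P′ → ∃[ Q′ ] (Q —[ vis η ]→ Q′ × P′ ≈ Q′)
      forth t with R-sim r t
      ... | Q′ , t′ , r′ = Q′ , t′ , go (rs (_ , t)) r′
      back : Q —[ vis η ]→ Q′ → ∃[ P′ ] (P —[ vis η ]→ P′ × P′ ≈ Q′)
      back t with R-sim (R-sym r) t
      ... | P′ , t′ , r′ = P′ , t′ , go (rs (_ , t′)) (R-sym r′)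

  ≈-refl : P ≈ P
  ≈-refl = visible-bisimulation⊆≈ {R = _≡_} (λ { refl → refl }) (λ { refl t → _ , t , refl }) refl

  ≈-sym : P ≈ Q → Q ≈ P
  ≈-sym (bis forth back) =
    bis (λ t → let P′ , t′ , r = back t  in P′ , t′ , ≈-sym r)
        (λ t → let Q′ , t′ , r = forth t in Q′ , t′ , ≈-sym r)

  ≈-trans : P ≈ Q → Q ≈ R → P ≈ R
  ≈-trans (bis forth₁ back₁) (bis forth₂ back₂) =
    bis (λ t → let _ , t′ , r₁ = forth₁ t ; R′ , t″ , r₂ = forth₂ t′ in R′ , t″ , ≈-trans r₁ r₂)
        (λ t → let _ , t′ , r₂ = back₂ t  ; P′ , t″ , r₁ = back₁ t′  in P′ , t″ , ≈-trans r₁ r₂)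

  ≈-isEquivalence : IsEquivalence _≈_
  ≈-isEquivalence = record { refl = ≈-refl ; sym = ≈-sym ; trans = ≈-trans }

  ≈-setoid : Setoid _ _
  ≈-setoid = record { isEquivalence = ≈-isEquivalence }

  data ParallelPair : Rel where
    par : A ≈ B → C ≈ C′ → ParallelPair (A ∣ C) (B ∣ C′)

  ∣-cong : A ≈ B → C ≈ C′ → A ∣ C ≈ B ∣ C′
  ∣-cong A≈B C≈C′ = visible-bisimulation⊆≈ par-sym sim (par A≈B C≈C′)
    where
    par-sym : Symmetric ParallelPair
    par-sym (par A≈B C≈C′) = par (≈-sym A≈B) (≈-sym C≈C′)
    sim : IsVisibleSimulation ParallelPair
    sim (par (bis forth _) C≈C′) (parL t) = let _ , t′ , r = forth t in _ , parL t′ , par r C≈C′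
    sim (par A≈B (bis forth _)) (parR t) = let _ , t′ , r = forth t in _ , parR t′ , par A≈B r

  ∣-congˡ : B ≈ C → A ∣ B ≈ A ∣ C
  ∣-congˡ = ∣-cong ≈-refl

  data Swapped : Rel where
    swap : Swapped (P ∣ Q) (Q ∣ P)

  ∣-comm : ∀ P Q → P ∣ Q ≈ Q ∣ P
  ∣-comm _ _ = visible-bisimulation⊆≈ (λ { swap → swap }) sim swap
    where
    sim : IsVisibleSimulation Swapped
    sim swap (parL t) = _ , parR t , swap
    sim swap (parR t) = _ , parL t , swap

  data Reassociated : Rel where
    to   : Reassociated ((P ∣ Q) ∣ R) (P ∣ (Q ∣ R))
    from : Reassociated (P ∣ (Q ∣ R)) ((P ∣ Q) ∣ R)

  ∣-assoc : ∀ P Q R → (P ∣ Q) ∣ R ≈ P ∣ (Q ∣ R)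
  ∣-assoc _ _ _ = visible-bisimulation⊆≈ (λ { to → from ; from → to }) sim to
    where
    sim : IsVisibleSimulation Reassociated
    sim to   (parL (parL t)) = _ , parL t , to
    sim to   (parL (parR t)) = _ , parR (parL t) , to
    sim to   (parR t)        = _ , parR (parR t) , to
    sim from (parL t)        = _ , parL (parL t) , from
    sim from (parR (parL t)) = _ , parL (parR t) , from
    sim from (parR (parR t)) = _ , parR t , from

  ∣-commutativeSemigroup : CommutativeSemigroup _ _
  ∣-commutativeSemigroup = record
    { _∙_ = _∣_
    ; isCommutativeSemigroup = record
      { isSemigroup = record
        { isMagma = record { isEquivalence = ≈-isEquivalence ; ∙-cong = ∣-cong }
        ; assoc = ∣-assoc
        }
      ; comm = ∣-comm
      }
    }

  open CommutativeSemigroupProperties ∣-commutativeSemigroup using (interchange)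
  open SetoidReasoning ≈-setoid

  EquivalentInParallel : Rel
  EquivalentInParallel A B = ∃[ C ] (A ∣ C ≈ B ∣ C)

  EquivalentInParallel-isVisibleSimulation : IsVisibleSimulation EquivalentInParallel
  EquivalentInParallel-isVisibleSimulation (_ , bis forth _) t with forth (parL t)
  ... | _ , parL t′ , r = _ , t′ , _ , r
  ... | _ , parR c  , r = chase (≺-wellFounded _) c r
    where
    -- The step of A was answered by C; let the residual of C perform the
    -- same action again. C shrinks, so eventually B has to answer.
    chase : Acc _≺_ C → C —[ vis η ]→ C′ → A′ ∣ C ≈ B ∣ C′ →
            ∃[ B′ ] (B —[ vis η ]→ B′ × EquivalentInParallel A′ B′)
    chase (acc rs) c (bis forth _) with forth (parR c)
    ... | _ , parL t′ , r = _ , t′ , _ , r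
    ... | _ , parR c′ , r = chase (rs (_ , c)) c′ r

  ∣-cancelʳ : A ∣ C ≈ B ∣ C → A ≈ B
  ∣-cancelʳ e =
    visible-bisimulation⊆≈ (λ (C , e) → C , ≈-sym e) EquivalentInParallel-isVisibleSimulation (_ , e)

  ∣-interchange-congʳ : A₁ ∣ A₂ ≈ A′ ∣ A → (A₁ ∣ R) ∣ (A₂ ∣ R) ≈ (A′ ∣ R) ∣ (A ∣ R)
  ∣-interchange-congʳ {A₁} {A₂} {A′} {A} {R} e = begin
    (A₁ ∣ R) ∣ (A₂ ∣ R) ≈⟨ interchange A₁ R A₂ R ⟩
    (A₁ ∣ A₂) ∣ (R ∣ R) ≈⟨ ∣-cong e ≈-refl ⟩
    (A′ ∣ A) ∣ (R ∣ R)  ≈⟨ interchange A′ R A R ⟨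
    (A′ ∣ R) ∣ (A ∣ R)  ∎

  ∣-interchange-congˡ : A₁ ∣ A₂ ≈ A′ ∣ A → (R ∣ A₁) ∣ (R ∣ A₂) ≈ (R ∣ A′) ∣ (R ∣ A)
  ∣-interchange-congˡ {A₁} {A₂} {A′} {A} {R} e = begin
    (R ∣ A₁) ∣ (R ∣ A₂) ≈⟨ interchange R A₁ R A₂ ⟩
    (R ∣ R) ∣ (A₁ ∣ A₂) ≈⟨ ∣-congˡ e ⟩
    (R ∣ R) ∣ (A′ ∣ A)  ≈⟨ interchange R A′ R A ⟨
    (R ∣ A′) ∣ (R ∣ A)  ∎

  ∣-cross : ∀ A′ C A C′ → (A′ ∣ C) ∣ (A ∣ C′) ≈ (A′ ∣ C′) ∣ (A ∣ C)
  ∣-cross A′ C A C′ = begin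
    (A′ ∣ C) ∣ (A ∣ C′) ≈⟨ interchange A′ C A C′ ⟩
    (A′ ∣ A) ∣ (C ∣ C′) ≈⟨ ∣-congˡ (∣-comm C C′) ⟩
    (A′ ∣ A) ∣ (C′ ∣ C) ≈⟨ interchange A′ C′ A C ⟨
    (A′ ∣ C′) ∣ (A ∣ C) ∎

  τ-split : A —[ τ ]→ A′ →
            ∃[ η ] ∃[ A₁ ] ∃[ A₂ ] (A —[ vis η ]→ A₁ × A —[ vis (co η) ]→ A₂ × A₁ ∣ A₂ ≈ A′ ∣ A)
  τ-split (com t u) = _ , _ , _ , parL t , parR u , ∣-cross _ _ _ _
  τ-split (parL t) = let η , _ , _ , t₁ , t₂ , e = τ-split t in
    η , _ , _ , parL t₁ , parL t₂ , ∣-interchange-congʳ e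
  τ-split (parR t) = let η , _ , _ , t₁ , t₂ , e = τ-split t in
    η , _ , _ , parR t₁ , parR t₂ , ∣-interchange-congˡ e

  τ-join : B —[ vis η ]→ B₁ → B —[ vis (co η) ]→ B₂ →
           ∃[ B′ ] (B —[ τ ]→ B′ × B₁ ∣ B₂ ≈ B′ ∣ B)
  τ-join {η = inp _} pre ()
  τ-join {η = out _} pre ()
  τ-join (parL t) (parL u) = let _ , t′ , e = τ-join t u in _ , parL t′ , ∣-interchange-congʳ e
  τ-join (parR t) (parR u) = let _ , t′ , e = τ-join t u in _ , parR t′ , ∣-interchange-congˡ e
  τ-join (parL t) (parR u) = _ , com t u , ∣-cross _ _ _ _
  τ-join {η = η} (parR t) (parL u) =
    _ , com u (subst (λ η′ → _ —[ vis η′ ]→ _) (sym (co-involutive η)) t) ,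
    ≈-trans (∣-comm _ _) (∣-cross _ _ _ _)

  ≈-τ-match : A ≈ B → A —[ τ ]→ A′ → ∃[ B′ ] (B —[ τ ]→ B′ × A′ ≈ B′)
  ≈-τ-match {A} {B} {A′} A≈B@(bis forth _) t
    with _ , A₁ , A₂ , t₁ , t₂ , A₁∣A₂≈A′∣A ← τ-split t
    with B₁ , u₁ , A₁≈B₁ ← forth t₁
    with B₂ , u₂ , A₂≈B₂ ← forth t₂
    with B′ , u , B₁∣B₂≈B′∣B ← τ-join u₁ u₂
    = B′ , u , ∣-cancelʳ (begin
      A′ ∣ A  ≈⟨ A₁∣A₂≈A′∣A ⟨
      A₁ ∣ A₂ ≈⟨ ∣-cong A₁≈B₁ A₂≈B₂ ⟩
      B₁ ∣ B₂ ≈⟨ B₁∣B₂≈B′∣B ⟩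
      B′ ∣ B  ≈⟨ ∣-congˡ A≈B ⟨
      B′ ∣ A  ∎)

  ≈-isBisimulation : IsBisimulation _≈_
  ≈-isBisimulation = ≈-sym , sim
    where
    sim : IsSimulation _≈_
    sim {μ = vis _} (bis forth _) t = forth t
    sim {μ = τ}     A≈B           t = ≈-τ-match A≈B t

  ∼⇒≈ : P ∼ Q → P ≈ Q
  ∼⇒≈ (_ , (R-sym , R-sim) , r) = visible-bisimulation⊆≈ R-sym R-sim r

  ≈⇒∼ : P ≈ Q → P ∼ Q
  ≈⇒∼ P≈Q = _≈_ , ≈-isBisimulation , P≈Q

  module _ (σ : Subst) where

    []-preserves-vis-step : P —[ vis η ]→ P′ → (P [ σ ]) —[ vis (substPre σ η) ]→ (P′ [ σ ])
    []-preserves-vis-step pre      = pre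
    []-preserves-vis-step (parL t) = parL ([]-preserves-vis-step t)
    []-preserves-vis-step (parR t) = parR ([]-preserves-vis-step t)

    []-reflects-vis-step : ∀ P {η′ A} → (P [ σ ]) —[ vis η′ ]→ A →
                           ∃[ η ] ∃[ P′ ] (P —[ vis η ]→ P′ × η′ ≡ substPre σ η × A ≡ P′ [ σ ])
    []-reflects-vis-step (η ∙ P) pre = η , P , pre , refl , refl
    []-reflects-vis-step (P ∣ Q) (parL t) with η , P′ , t′ , refl , refl ← []-reflects-vis-step P t =
      η , P′ ∣ Q , parL t′ , refl , refl
    []-reflects-vis-step (P ∣ Q) (parR t) with η , Q′ , t′ , refl , refl ← []-reflects-vis-step Q t =
      η , P ∣ Q′ , parR t′ , refl , refl

    ≈-subst : P ≈ Q → P [ σ ] ≈ Q [ σ ]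
    ≈-subst {P} {Q} (bis forth back) = bis forth′ back′
      where
      forth′ : (P [ σ ]) —[ vis η ]→ A → ∃[ B ] ((Q [ σ ]) —[ vis η ]→ B × A ≈ B)
      forth′ t with _ , _ , t′ , refl , refl ← []-reflects-vis-step P t
               with Q′ , u , r ← forth t′
        = Q′ [ σ ] , []-preserves-vis-step u , ≈-subst r
      back′ : (Q [ σ ]) —[ vis η ]→ B → ∃[ A ] ((P [ σ ]) —[ vis η ]→ A × A ≈ B)
      back′ t with _ , _ , t′ , refl , refl ← []-reflects-vis-step Q t
              with P′ , u , r ← back t′
        = P′ [ σ ] , []-preserves-vis-step u , ≈-subst r

corollary4p5 : (Name : Set) → let open MicroCCS Name in
    (σ : Subst) (P Q : Proc) → P ∼ Q → (P [ σ ]) ∼ (Q [ σ ])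
corollary4p5 _ σ _ _ = ≈⇒∼ ∘ ≈-subst σ ∘ ∼⇒≈
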